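{- Let $a_1,\dots,a_n$ be positive integers, $b$ a positive integer, and $L$ an integer with $L>2\sum_{i\in[n]}a_i$. Let $G$ be the graph with vertices $s=u_0,u_1,\dots,u_n,t$ and, for each $i\in[n]$, two additional vertices $m_i,m'_i$, with edges $u_{i-1}m_i$ and $m_iu_i$ both of weight $L+2a_i$, edges $u_{i-1}m'_i$ of weight $L+a_i$ and $m'_iu_i$ of weight $L+3a_i$, and an edge $u_nt$ of weight $2b$. Then for real numbers $c,r$, there exists a path $\pi$ from $s$ to $u_n$ in $G$ with $\mathrm{opt}(\pi)=c$ and $\varphi(\pi)=r$ if and only if there exists $I\subseteq[n]$ with $r=2\sum_{i\in I}a_i$ and $c=nL+2\sum_{i\in[n]}a_i+\sum_{i\in I}a_i$.
   Context: $[n]=\{1,\dots,n\}$. A power assignment is $p\colon V\to\mathbb{R}_{\ge0}$ with cost $\sum_v p(v)$; an edge $uv$ is activated if $p(u)+p(v)\ge w(uv)$. For a path $\pi$, $\mathrm{opt}(\pi)$ is the minimum cost of a power assignment activating all edges of $\pi$. The greedy power assignment along a path $\pi=v_0,\dots,v_k$ is $p^*_\pi(v)=0$ if $v$ is not on $\pi$ or $v=v_0$; for $i>0$, $p^*_\pi(v_i)=0$ if $p^*_\pi(v_{i-1})\ge w(v_{i-1}v_i)$ and $p^*_\pi(v_i)=w(v_{i-1}v_i)-p^*_\pi(v_{i-1})$ otherwise. Set $\varphi(\pi)=p^*_\pi(v_k)$.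
   Formalization: The numbers c and r, and the power assignments whose minimum cost defines opt(π), take rational values instead of real ones. -}

module Defs where

open import Data.Nat as ℕ using (ℕ)
open import Data.Integer as ℤ using (ℤ)
open import Data.Rational using (ℚ; 0ℚ; _+_; _-_; _≤_; _≤ᵇ_; _/_)
open import Data.Bool using (Bool; true; false; if_then_else_)
open import Data.Fin using (Fin; zero; suc; inject₁; fromℕ)
open import Data.Fin.Properties using (_≟_)
open import Data.Fin.Subset using (Subset; _∈_)
open import Data.Maybe using (Maybe; just; nothing; fromMaybe; _<∣>_; Is-just)
open import Data.List using (List; []; _∷_; _++_; map; allFin; foldr)
open import Data.List.Relation.Unary.Unique.Propositional using (Unique)
open import Data.Vec using (Vec; []; _∷_)
open import Data.Product using (_×_; Σ; ∃)
open import Data.Unit using (⊤)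
open import Relation.Nullary using (yes; no)
open import Relation.Binary.PropositionalEquality using (_≡_)

-- A graph is given by a vertex type V, a finite enumeration of its
-- vertices (to define the cost Σ_v p(v)), and a symmetric partial
-- weight function  w : V → V → Maybe ℚ  (nothing = no edge).

record WGraph : Set₁ where
  field
    V        : Set
    vertices : List V
    weight   : V → V → Maybe ℚ

module _ (G : WGraph) where
  open WGraph G

  w : V → V → ℚ
  w x y = fromMaybe 0ℚ (weight x y)

  IsWalk : V → List V → Set
  IsWalk v₀ []       = ⊤
  IsWalk v₀ (v ∷ vs) = Is-just (weight v₀ v) × IsWalk v vs

  IsPath : V → List V → Set
  IsPath v₀ vs = IsWalk v₀ vs × Unique (v₀ ∷ vs)

  lastV : V → List V → V
  lastV v₀ []       = v₀
  lastV v₀ (v ∷ vs) = lastV v vs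

  NonNeg : (V → ℚ) → Set
  NonNeg p = ∀ v → 0ℚ ≤ p v

  cost : (V → ℚ) → ℚ
  cost p = foldr (λ v acc → p v + acc) 0ℚ vertices

  ActivatesAll : (V → ℚ) → V → List V → Set
  ActivatesAll p v₀ []       = ⊤
  ActivatesAll p v₀ (v ∷ vs) = (w v₀ v ≤ p v₀ + p v) × ActivatesAll p v vs

  IsOpt : V → List V → ℚ → Set
  IsOpt v₀ vs c =
    (Σ (V → ℚ) λ p → NonNeg p × ActivatesAll p v₀ vs × cost p ≡ c)
    × (∀ p → NonNeg p → ActivatesAll p v₀ vs → c ≤ cost p)

  -- greedy power assignment; greedyGo x prev rest, x = p*(prev)
  greedyGo : ℚ → V → List V → ℚ
  greedyGo x prev []       = x
  greedyGo x prev (v ∷ vs) =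
    greedyGo (if w prev v ≤ᵇ x then 0ℚ else w prev v - x) v vs

  φ : V → List V → ℚ
  φ v₀ vs = greedyGo 0ℚ v₀ vs

data Vtx (n : ℕ) : Set where
  u  : Fin (ℕ.suc n) → Vtx n
  m  : Fin n → Vtx n
  m' : Fin n → Vtx n
  t  : Vtx n

toℚ : ℤ → ℚ
toℚ z = z / 1

sumFin : ∀ {n} → (Fin n → ℕ) → ℕ
sumFin {ℕ.zero}  f = 0
sumFin {ℕ.suc n} f = f zero ℕ.+ sumFin (λ i → f (suc i))

sumOver : ∀ {n} → Subset n → (Fin n → ℕ) → ℕ
sumOver []          f = 0
sumOver (true ∷ I)  f = f zero ℕ.+ sumOver I (λ i → f (suc i))
sumOver (false ∷ I) f = sumOver I (λ i → f (suc i))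

module Gadget (n : ℕ) (a : Fin n → ℕ) (b : ℕ) (L : ℤ) where

  -- index j : Fin n stands for i = j+1 ∈ [n]; u_{i-1} = u (inject₁ j), u_i = u (suc j)
  wt : ℕ → Fin n → ℚ
  wt k j = toℚ (L ℤ.+ ℤ.+ (k ℕ.* a j))

  -- directed description of each edge (symmetrised below)
  dir : Vtx n → Vtx n → Maybe ℚ
  dir (u i) (m j) with i ≟ inject₁ j
  ... | yes _ = just (wt 2 j)
  ... | no  _ = nothing
  dir (m j) (u i) with i ≟ suc j
  ... | yes _ = just (wt 2 j)
  ... | no  _ = nothing
  dir (u i) (m' j) with i ≟ inject₁ j
  ... | yes _ = just (wt 1 j)
  ... | no  _ = nothing
  dir (m' j) (u i) with i ≟ suc j
  ... | yes _ = just (wt 3 j)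
  ... | no  _ = nothing
  dir (u i) t with i ≟ fromℕ n
  ... | yes _ = just (toℚ (ℤ.+ (2 ℕ.* b)))
  ... | no  _ = nothing
  dir _ _ = nothing

  G : WGraph
  G = record
    { V        = Vtx n
    ; vertices = map u (allFin (ℕ.suc n)) ++ map m (allFin n)
                 ++ map m' (allFin n) ++ (t ∷ [])
    ; weight   = λ x y → dir x y <∣> dir y x
    }

  s : Vtx n
  s = u zero

  uₙ : Vtx n
  uₙ = u (fromℕ n)

-- A simple path from s = u₀ to uₙ can neither pass through t (whose only neighbour is uₙ)
-- nor step back to a smaller hub, so it crosses the gaps 1, …, n in order, each through mᵢ
-- or through m′ᵢ; the gaps crossed through m′ᵢ form the subset I.
-- Along such a path the greedy value at the hubs stays below L: through mᵢ (weights L + 2aᵢ,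
-- L + 2aᵢ) it is unchanged, through m′ᵢ (weights L + aᵢ, L + 3aᵢ) it grows by 2aᵢ, so
-- φ = 2 Σ_{i ∈ I} aᵢ.  The path's edges from middle vertices to the uᵢ are pairwise disjoint, so
-- every activating assignment costs at least the sum of their weights, nL + 2 Σ aᵢ + Σ_{i ∈ I} aᵢ,
-- and putting exactly that weight on the middle vertices also activates the lighter entry edges.

module Submission where

open import Defs
open import Data.Nat as ℕ using (ℕ)
open import Data.Integer as ℤ using (ℤ; +_; _*_; _+_)
open import Data.Rational using (ℚ)
open import Data.Fin using (Fin)
open import Data.Fin.Subset using (Subset)
open import Data.List using (List)
open import Data.Product using (Σ; _×_)
open import Function.Bundles using (_⇔_)
open import Relation.Binary.PropositionalEquality using (_≡_)

open import Data.Nat using (zero; suc)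
import Data.Nat.Properties as ℕP
import Data.Integer.Properties as ℤP
open import Data.Integer.Solver using (module +-*-Solver)
import Data.Rational as ℚ
open import Data.Rational using (mkℚ; 0ℚ)
import Data.Rational.Properties as ℚP
import Data.Rational.Solver as ℚ-Solver
open import Data.Nat.Coprimality using (1-coprimeTo) renaming (sym to coprime-sym)
open import Data.Bool using (Bool; true; false; if_then_else_; T)
open import Data.Unit using (⊤; tt)
open import Data.Empty using (⊥; ⊥-elim)
open import Data.Sum using (_⊎_; inj₁; inj₂)
open import Data.Product using (_,_; proj₁; proj₂)
open import Data.Maybe using (Maybe; just; Is-just; fromMaybe)
open import Data.Maybe.Relation.Unary.Any using (just)
open import Data.Fin using (zero; suc; inject₁; fromℕ; toℕ)
open import Data.Fin.Properties using (_≟_; fromℕ≢inject₁; toℕ-injective; toℕ-inject₁; toℕ-fromℕ)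
open import Data.Vec using (Vec; []; _∷_; lookup)
open import Data.List using ([]; _∷_; _++_; foldr; map; allFin; tabulate)
open import Data.List.Properties using (map-tabulate; foldr-++)
open import Data.List.Relation.Unary.All using (All; []; _∷_)
  renaming (map to All-map; zipWith to All-zipWith; universal to All-universal)
open import Data.List.Relation.Unary.AllPairs using ([]; _∷_)
open import Data.List.Relation.Unary.Unique.Propositional using (Unique)
open import Function using (_∘_; id)
open import Function.Bundles using (mk⇔; Equivalence)
open import Relation.Binary.PropositionalEquality
  using (_≢_; refl; sym; trans; cong; cong₂; subst; subst₂; module ≡-Reasoning)
open import Relation.Nullary using (yes; no)
open import Relation.Nullary.Decidable using (dec-yes-recompute)
open import Algebra.Properties.CommutativeMonoid.Sum ℚP.+-0-commutativeMonoid
  using (sum; sum-cong-≗; ∑-distrib-+; sum-replicate-zero)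

-- toℚ z in normal form, on which the operations of ℚ compute.
fromℤ : ℤ → ℚ
fromℤ z = mkℚ z 0 (coprime-sym (1-coprimeTo _))

toℚ≡fromℤ : ∀ z → toℚ z ≡ fromℤ z
toℚ≡fromℤ z = ℚP.↥p/↧p≡p (fromℤ z)

toℚ-+ : ∀ x y → toℚ x ℚ.+ toℚ y ≡ toℚ (x + y)
toℚ-+ x y = begin
  toℚ x ℚ.+ toℚ y    ≡⟨ cong₂ ℚ._+_ (toℚ≡fromℤ x) (toℚ≡fromℤ y) ⟩
  fromℤ x ℚ.+ fromℤ y ≡⟨ cong toℚ (cong₂ _+_ (ℤP.*-identityʳ x) (ℤP.*-identityʳ y)) ⟩
  toℚ (x + y)        ∎
  where open ≡-Reasoning

fromℤ-neg : ∀ x → ℚ.- fromℤ x ≡ fromℤ (ℤ.- x)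
fromℤ-neg (+ zero)    = refl
fromℤ-neg (+ suc _)   = refl
fromℤ-neg ℤ.-[1+ _ ]  = refl

toℚ-- : ∀ x y → toℚ x ℚ.- toℚ y ≡ toℚ (x ℤ.- y)
toℚ-- x y = begin
  toℚ x ℚ.- toℚ y         ≡⟨ cong (λ q → toℚ x ℚ.- q) (toℚ≡fromℤ y) ⟩
  toℚ x ℚ.+ ℚ.- fromℤ y    ≡⟨ cong (toℚ x ℚ.+_) (trans (fromℤ-neg y) (sym (toℚ≡fromℤ (ℤ.- y)))) ⟩
  toℚ x ℚ.+ toℚ (ℤ.- y)    ≡⟨ toℚ-+ x (ℤ.- y) ⟩
  toℚ (x ℤ.- y)           ∎
  where open ≡-Reasoning

toℚ-mono-≤ : ∀ {x y} → x ℤ.≤ y → toℚ x ℚ.≤ toℚ y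
toℚ-mono-≤ {x} {y} x≤y rewrite toℚ≡fromℤ x | toℚ≡fromℤ y =
  ℚ.*≤* (subst₂ ℤ._≤_ (sym (ℤP.*-identityʳ x)) (sym (ℤP.*-identityʳ y)) x≤y)

greedyPower : ℚ → ℚ → ℚ
greedyPower w x = if w ℚ.≤ᵇ x then 0ℚ else w ℚ.- x

0≤w-x⇒greedyPower≡w-x : ∀ {w x} → 0ℚ ℚ.≤ w ℚ.- x → greedyPower w x ≡ w ℚ.- x
0≤w-x⇒greedyPower≡w-x {w} {x} 0≤w-x with w ℚ.≤ᵇ x in w≤ᵇx
... | false = refl
... | true  = ℚP.≤-antisym 0≤w-x (begin
  w ℚ.- x ≤⟨ ℚP.+-monoˡ-≤ (ℚ.- x) (ℚP.≤ᵇ⇒≤ {w} {x} (subst T (sym w≤ᵇx) tt)) ⟩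
  x ℚ.- x ≡⟨ ℚP.+-inverseʳ x ⟩
  0ℚ      ∎)
  where open ℚP.≤-Reasoning

greedyPower-toℚ : ∀ W Y → + 0 ℤ.≤ W ℤ.- Y → greedyPower (toℚ W) (toℚ Y) ≡ toℚ (W ℤ.- Y)
greedyPower-toℚ W Y 0≤W-Y = trans (0≤w-x⇒greedyPower≡w-x {toℚ W} {toℚ Y} 0≤toℚ[W-Y]) (toℚ-- W Y)
  where
  0≤toℚ[W-Y] : 0ℚ ℚ.≤ toℚ W ℚ.- toℚ Y
  0≤toℚ[W-Y] = subst (0ℚ ℚ.≤_) (sym (toℚ-- W Y)) (toℚ-mono-≤ {+ 0} {W ℤ.- Y} 0≤W-Y)

greedyPower-twice : ∀ L p d X → + X ℤ.≤ L →
  greedyPower (toℚ (L + + (p ℕ.+ d))) (greedyPower (toℚ (L + + p)) (toℚ (+ X))) ≡ toℚ (+ (X ℕ.+ d))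
greedyPower-twice L p d X X≤L = begin
  greedyPower (toℚ (L + + (p ℕ.+ d))) (greedyPower (toℚ (L + + p)) (toℚ (+ X)))
    ≡⟨ cong (greedyPower (toℚ (L + + (p ℕ.+ d)))) (greedyPower-toℚ (L + + p) (+ X) 0≤L+p-X) ⟩
  greedyPower (toℚ (L + + (p ℕ.+ d))) (toℚ (L + + p ℤ.- + X))
    ≡⟨ greedyPower-toℚ (L + + (p ℕ.+ d)) (L + + p ℤ.- + X)
                       (subst (+ 0 ℤ.≤_) (sym telescope) (ℤ.+≤+ ℕ.z≤n)) ⟩
  toℚ (L + + (p ℕ.+ d) ℤ.- (L + + p ℤ.- + X))
    ≡⟨ cong toℚ telescope ⟩
  toℚ (+ (X ℕ.+ d)) ∎
  where
  open ≡-Reasoning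
  open +-*-Solver
  0≤L+p-X : + 0 ℤ.≤ L + + p ℤ.- + X
  0≤L+p-X = ℤP.i≤j⇒0≤j-i (ℤP.≤-trans X≤L (ℤP.i≤i+j L (+ p)))
  telescope : L + + (p ℕ.+ d) ℤ.- (L + + p ℤ.- + X) ≡ + (X ℕ.+ d)
  telescope = begin
    L + + (p ℕ.+ d) ℤ.- (L + + p ℤ.- + X) ≡⟨ cong (λ q → L + q ℤ.- (L + + p ℤ.- + X)) (ℤP.pos-+ p d) ⟩
    L + (+ p + + d) ℤ.- (L + + p ℤ.- + X) ≡⟨ solve 4 (λ L p d X → L :+ (p :+ d) :- (L :+ p :- X) := X :+ d)
                                                   refl L (+ p) (+ d) (+ X) ⟩
    + X + + d                             ≡⟨ sym (ℤP.pos-+ X d) ⟩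
    + (X ℕ.+ d)                           ∎

p≤p+q : ∀ {p q} → 0ℚ ℚ.≤ q → p ℚ.≤ p ℚ.+ q
p≤p+q {p} {q} 0≤q = subst (ℚ._≤ p ℚ.+ q) (ℚP.+-identityʳ p) (ℚP.+-monoʳ-≤ p 0≤q)

p≤q+p : ∀ {p q} → 0ℚ ℚ.≤ q → p ℚ.≤ q ℚ.+ p
p≤q+p {p} {q} 0≤q = subst (p ℚ.≤_) (ℚP.+-comm p q) (p≤p+q 0≤q)

sum-mono-≤ : ∀ {k} {f g : Fin k → ℚ} → (∀ j → f j ℚ.≤ g j) → sum f ℚ.≤ sum g
sum-mono-≤ {zero}  f≤g = ℚP.≤-refl
sum-mono-≤ {suc k} f≤g = ℚP.+-mono-≤ (f≤g zero) (sum-mono-≤ (f≤g ∘ suc))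

foldr-map-allFin : ∀ {A : Set} {k} (p : A → ℚ) (h : Fin k → A) e →
                   foldr (λ v acc → p v ℚ.+ acc) e (map h (allFin k)) ≡ sum (p ∘ h) ℚ.+ e
foldr-map-allFin {A} p h e = trans (cong (foldr _ e) (map-tabulate id h)) (go h)
  where
  go : ∀ {k} (h : Fin k → A) → foldr (λ v acc → p v ℚ.+ acc) e (tabulate h) ≡ sum (p ∘ h) ℚ.+ e
  go {zero}  h = sym (ℚP.+-identityˡ e)
  go {suc k} h = trans (cong (p (h zero) ℚ.+_) (go (h ∘ suc)))
                       (sym (ℚP.+-assoc (p (h zero)) _ e))

IsOpt-unique : ∀ G {v vs c c′} → IsOpt G v vs c → IsOpt G v vs c′ → c ≡ c′
IsOpt-unique G ((p , p≥0 , p-act , cost≡c) , c-min) ((p′ , p′≥0 , p′-act , cost≡c′) , c′-min) =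
  ℚP.≤-antisym (subst (_ ℚ.≤_) cost≡c′ (c-min p′ p′≥0 p′-act))
               (subst (_ ℚ.≤_) cost≡c (c′-min p p≥0 p-act))

-- A gap i is crossed through mᵢ (false) or m′ᵢ (true); the edges u_{i-1} – mid and mid – uᵢ
-- then weigh L + entryCoeff · aᵢ and L + exitCoeff · aᵢ.
entryCoeff exitCoeff : Bool → ℕ
entryCoeff false = 2
entryCoeff true  = 1
exitCoeff false = 2
exitCoeff true  = 3

selected : Bool → ℕ → ℕ
selected false _ = 0
selected true  y = y

entryCoeff≤exitCoeff : ∀ bb → entryCoeff bb ℕ.≤ exitCoeff bb
entryCoeff≤exitCoeff false = ℕP.≤-refl
entryCoeff≤exitCoeff true  = ℕ.s≤s ℕ.z≤n

exitCoeff-*-entry : ∀ bb y → exitCoeff bb ℕ.* y ≡ entryCoeff bb ℕ.* y ℕ.+ 2 ℕ.* selected bb y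
exitCoeff-*-entry false y = sym (ℕP.+-identityʳ _)
exitCoeff-*-entry true  y = ℕP.*-distribʳ-+ y 1 2

exitCoeff-* : ∀ bb y → exitCoeff bb ℕ.* y ≡ 2 ℕ.* y ℕ.+ selected bb y
exitCoeff-* false y = sym (ℕP.+-identityʳ _)
exitCoeff-* true  y = trans (ℕP.*-distribʳ-+ y 2 1) (cong (2 ℕ.* y ℕ.+_) (ℕP.*-identityˡ y))

sumOver-∷ : ∀ {k} bb (I : Vec Bool k) f → sumOver (bb ∷ I) f ≡ selected bb (f zero) ℕ.+ sumOver I (f ∘ suc)
sumOver-∷ false I f = refl
sumOver-∷ true  I f = refl

sumOver≤sumFin : ∀ {k} (I : Vec Bool k) f → sumOver I f ℕ.≤ sumFin f
sumOver≤sumFin []          f = ℕ.z≤n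
sumOver≤sumFin (true  ∷ I) f = ℕP.+-monoʳ-≤ (f zero) (sumOver≤sumFin I (f ∘ suc))
sumOver≤sumFin (false ∷ I) f = ℕP.≤-trans (sumOver≤sumFin I (f ∘ suc)) (ℕP.m≤n+m _ (f zero))

exitWeight-sum : ∀ L {k} (y : Fin k → ℕ) (I : Vec Bool k) →
  sum (λ j → toℚ (L + + (exitCoeff (lookup I j) ℕ.* y j)))
    ≡ toℚ (+ k * L + + (2 ℕ.* sumFin y) + + sumOver I y)
exitWeight-sum L y []                = refl
exitWeight-sum L {suc k} y (bb ∷ I) = begin
  toℚ (L + + (exitCoeff bb ℕ.* y zero)) ℚ.+ sum (λ j → toℚ (L + + (exitCoeff (lookup I j) ℕ.* y (suc j))))
    ≡⟨ cong (toℚ (L + + (exitCoeff bb ℕ.* y zero)) ℚ.+_) (exitWeight-sum L (y ∘ suc) I) ⟩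
  toℚ (L + + (exitCoeff bb ℕ.* y zero)) ℚ.+ toℚ (+ k * L + + (2 ℕ.* S) + + R)
    ≡⟨ toℚ-+ (L + + (exitCoeff bb ℕ.* y zero)) (+ k * L + + (2 ℕ.* S) + + R) ⟩
  toℚ (L + + (exitCoeff bb ℕ.* y zero) + (+ k * L + + (2 ℕ.* S) + + R))
    ≡⟨ cong toℚ rearrange ⟩
  toℚ (+ suc k * L + + (2 ℕ.* sumFin y) + + sumOver (bb ∷ I) y) ∎
  where
  open ≡-Reasoning
  open +-*-Solver
  s S R : ℕ
  s = selected bb (y zero)
  S = sumFin (y ∘ suc)
  R = sumOver I (y ∘ suc)
  rearrange : L + + (exitCoeff bb ℕ.* y zero) + (+ k * L + + (2 ℕ.* S) + + R)
            ≡ + suc k * L + + (2 ℕ.* sumFin y) + + sumOver (bb ∷ I) y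
  rearrange = begin
    L + + (exitCoeff bb ℕ.* y zero) + (+ k * L + + (2 ℕ.* S) + + R)
      ≡⟨ cong₂ (λ p q → L + p + (+ k * L + q + + R))
               (trans (cong +_ (exitCoeff-* bb (y zero))) (ℤP.pos-+ (2 ℕ.* y zero) s)) (ℤP.pos-* 2 S) ⟩
    L + (+ (2 ℕ.* y zero) + + s) + (+ k * L + + 2 * + S + + R)
      ≡⟨ cong (λ p → L + (p + + s) + (+ k * L + + 2 * + S + + R)) (ℤP.pos-* 2 (y zero)) ⟩
    L + (+ 2 * + y zero + + s) + (+ k * L + + 2 * + S + + R)
      ≡⟨ solve 6 (λ L y s k S R → L :+ (con (+ 2) :* y :+ s) :+ (k :* L :+ con (+ 2) :* S :+ R)
                               := (con (+ 1) :+ k) :* L :+ con (+ 2) :* (y :+ S) :+ (s :+ R))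
               refl L (+ y zero) (+ s) (+ k) (+ S) (+ R) ⟩
    + suc k * L + + 2 * (+ y zero + + S) + (+ s + + R)
      ≡⟨ cong₂ (λ p q → + suc k * L + p + q)
               (sym (trans (ℤP.pos-* 2 (y zero ℕ.+ S)) (cong (+ 2 *_) (ℤP.pos-+ (y zero) S))))
               (sym (trans (cong +_ (sumOver-∷ bb I y)) (ℤP.pos-+ s R))) ⟩
    + suc k * L + + (2 ℕ.* sumFin y) + + sumOver (bb ∷ I) y ∎

module GadgetProperties (n : ℕ) (a : Fin n → ℕ) (b : ℕ) (L : ℤ) where
  open Gadget n a b L
  open WGraph G using (weight)

  mid : Bool → Fin n → Vtx n
  mid false = m
  mid true  = m'

  weight-entry : ∀ bb j → weight (u (inject₁ j)) (mid bb j) ≡ just (wt (entryCoeff bb) j)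
  weight-entry false j rewrite dec-yes-recompute (inject₁ j ≟ inject₁ j) refl = refl
  weight-entry true  j rewrite dec-yes-recompute (inject₁ j ≟ inject₁ j) refl = refl

  weight-exit : ∀ bb j → weight (mid bb j) (u (suc j)) ≡ just (wt (exitCoeff bb) j)
  weight-exit false j rewrite dec-yes-recompute (suc j ≟ suc j) refl = refl
  weight-exit true  j rewrite dec-yes-recompute (suc j ≟ suc j) refl = refl

  data HubStep (i : Fin (suc n)) : Vtx n → Set where
    forward  : ∀ bb j → i ≡ inject₁ j → HubStep i (mid bb j)
    backward : ∀ bb j → i ≡ suc j → HubStep i (mid bb j)
    toSink   : i ≡ fromℕ n → HubStep i t

  -- In the omitted cases the weight is nothing, so Agda sees that adj is absurd.
  hub-neighbour : ∀ i v → Is-just (weight (u i) v) → HubStep i v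
  hub-neighbour i (m j) adj with i ≟ inject₁ j | i ≟ suc j
  ... | yes e | _     = forward false j e
  ... | no _  | yes e = backward false j e
  hub-neighbour i (m' j) adj with i ≟ inject₁ j | i ≟ suc j
  ... | yes e | _     = forward true j e
  ... | no _  | yes e = backward true j e
  hub-neighbour i t adj with i ≟ fromℕ n
  ... | yes e = toSink e

  mid-neighbour : ∀ bb j v → Is-just (weight (mid bb j) v) → v ≡ u (inject₁ j) ⊎ v ≡ u (suc j)
  mid-neighbour false j (u i) adj with i ≟ suc j | i ≟ inject₁ j
  ... | yes e | _     = inj₂ (cong u e)
  ... | no _  | yes e = inj₁ (cong u e)
  mid-neighbour true j (u i) adj with i ≟ suc j | i ≟ inject₁ j
  ... | yes e | _     = inj₂ (cong u e)
  ... | no _  | yes e = inj₁ (cong u e)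

  sink-neighbour : ∀ v → Is-just (weight t v) → v ≡ u (fromℕ n)
  sink-neighbour (u i) adj with i ≟ fromℕ n
  ... | yes e = cong u e

  mid≢u : ∀ bb j i → mid bb j ≢ u i
  mid≢u false j i ()
  mid≢u true  j i ()

  route : ∀ {k} → Vec Bool k → (Fin k → Fin n) → List (Vtx n)
  route []       f = []
  route (bb ∷ I) f = mid bb (f zero) ∷ u (suc (f zero)) ∷ route I (f ∘ suc)

  -- f enumerates the gaps i, i + 1, … crossed by a route that starts at the hub u i.
  Gaps : ∀ {k} → Fin (suc n) → (Fin k → Fin n) → Set
  Gaps i f = ∀ h → toℕ (f h) ≡ toℕ i ℕ.+ toℕ h

  Gaps-id : Gaps zero id
  Gaps-id h = refl

  Gaps-head : ∀ {k i} {f : Fin (suc k) → Fin n} → Gaps i f → toℕ (f zero) ≡ toℕ i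
  Gaps-head {i = i} gaps = trans (gaps zero) (ℕP.+-identityʳ (toℕ i))

  toℕ-hub : ∀ {i : Fin (suc n)} {j} → i ≡ inject₁ j → toℕ i ≡ toℕ j
  toℕ-hub {j = j} i≡j = trans (cong toℕ i≡j) (toℕ-inject₁ j)

  Gaps-entry : ∀ {k i} {f : Fin (suc k) → Fin n} → Gaps i f → i ≡ inject₁ (f zero)
  Gaps-entry {f = f} gaps = toℕ-injective (sym (trans (toℕ-inject₁ (f zero)) (Gaps-head gaps)))

  Gaps-gap : ∀ {k i j} {f : Fin (suc k) → Fin n} → Gaps i f → i ≡ inject₁ j → j ≡ f zero
  Gaps-gap gaps i≡j = toℕ-injective (trans (sym (toℕ-hub i≡j)) (sym (Gaps-head gaps)))

  Gaps-next : ∀ {k i j} {f : Fin (suc k) → Fin n} → Gaps i f → i ≡ inject₁ j → Gaps (suc j) (f ∘ suc)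
  Gaps-next {i = i} {j} {f} gaps i≡j h = begin
    toℕ (f (suc h))       ≡⟨ gaps (suc h) ⟩
    toℕ i ℕ.+ suc (toℕ h) ≡⟨ ℕP.+-suc (toℕ i) (toℕ h) ⟩
    suc (toℕ i ℕ.+ toℕ h) ≡⟨ cong (λ x → suc (x ℕ.+ toℕ h)) (toℕ-hub i≡j) ⟩
    suc (toℕ j ℕ.+ toℕ h) ∎
    where open ≡-Reasoning

  Gaps-tail : ∀ {k i} {f : Fin (suc k) → Fin n} → Gaps i f → Gaps (suc (f zero)) (f ∘ suc)
  Gaps-tail gaps = Gaps-next gaps (Gaps-entry gaps)

  span-next : ∀ {k i j} → toℕ i ℕ.+ suc k ≡ n → i ≡ inject₁ j → toℕ (suc j) ℕ.+ k ≡ n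
  span-next {k} {i} {j} i+k≡n i≡j = begin
    suc (toℕ j ℕ.+ k) ≡⟨ cong (λ x → suc (x ℕ.+ k)) (toℕ-hub i≡j) ⟨
    suc (toℕ i ℕ.+ k) ≡⟨ ℕP.+-suc (toℕ i) k ⟨
    toℕ i ℕ.+ suc k   ≡⟨ i+k≡n ⟩
    n                 ∎
    where open ≡-Reasoning

  hub≡last : ∀ {i} → toℕ i ℕ.+ 0 ≡ n → i ≡ fromℕ n
  hub≡last {i} i+0≡n = toℕ-injective (trans (trans (sym (ℕP.+-identityʳ (toℕ i))) i+0≡n) (sym (toℕ-fromℕ n)))

  just≡⇒Is-just : ∀ {x : Maybe ℚ} {y} → x ≡ just y → Is-just x
  just≡⇒Is-just refl = just tt

  route-walk : ∀ {k i} (I : Vec Bool k) {f} → Gaps i f → IsWalk G (u i) (route I f)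
  route-walk []           gaps = tt
  route-walk (bb ∷ I) {f} gaps rewrite Gaps-entry gaps =
    just≡⇒Is-just (weight-entry bb (f zero)) , just≡⇒Is-just (weight-exit bb (f zero)) ,
    route-walk I (Gaps-tail gaps)

  route-last : ∀ {k i} (I : Vec Bool k) {f} → Gaps i f → toℕ i ℕ.+ k ≡ n →
               lastV G (u i) (route I f) ≡ u (fromℕ n)
  route-last []       gaps i+0≡n = cong u (hub≡last i+0≡n)
  route-last (bb ∷ I) gaps i+k≡n = route-last I (Gaps-tail gaps) (span-next i+k≡n (Gaps-entry gaps))

  Beyond : ℕ → Vtx n → Set
  Beyond o (u i)  = o ℕ.< toℕ i
  Beyond o (m j)  = o ℕ.≤ toℕ j
  Beyond o (m' j) = o ℕ.≤ toℕ j
  Beyond o t      = ⊥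

  Beyond-pred : ∀ {o} v → Beyond (suc o) v → Beyond o v
  Beyond-pred (u i)  = ℕP.<⇒≤
  Beyond-pred (m j)  = ℕP.<⇒≤
  Beyond-pred (m' j) = ℕP.<⇒≤

  Beyond-mid : ∀ bb j → Beyond (toℕ j) (mid bb j)
  Beyond-mid false j = ℕP.≤-refl
  Beyond-mid true  j = ℕP.≤-refl

  hub∉Beyond : ∀ {i} v → Beyond (toℕ i) v → u i ≢ v
  hub∉Beyond (u i) i<i refl = ℕP.<-irrefl refl i<i

  mid∉Beyond : ∀ bb j v → Beyond (suc (toℕ j)) v → mid bb j ≢ v
  mid∉Beyond false j (m j)  j<j refl = ℕP.<-irrefl refl j<j
  mid∉Beyond true  j (m' j) j<j refl = ℕP.<-irrefl refl j<j

  route-beyond : ∀ {k i} (I : Vec Bool k) {f} → Gaps i f → All (Beyond (toℕ i)) (route I f)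
  route-beyond []           gaps = []
  route-beyond (bb ∷ I) {f} gaps = subst (λ o → All (Beyond o) (route (bb ∷ I) f)) (Gaps-head gaps)
    (Beyond-mid bb (f zero) ∷ ℕP.n<1+n (toℕ (f zero)) ∷
     All-map (λ {v} → Beyond-pred v) (route-beyond I (Gaps-tail gaps)))

  route-unique : ∀ {k i} (I : Vec Bool k) {f} → Gaps i f → Unique (u i ∷ route I f)
  route-unique []           gaps = [] ∷ []
  route-unique (bb ∷ I) {f} gaps =
    All-map (λ {v} → hub∉Beyond v) (route-beyond (bb ∷ I) gaps)
    ∷ (mid≢u bb (f zero) (suc (f zero)) ∷
       All-map (λ {v} → mid∉Beyond bb (f zero) v) (route-beyond I (Gaps-tail gaps)))
    ∷ route-unique I (Gaps-tail gaps)

  -- Rules out backward hops in path⇒route; uniqueness of the path keeps it invariant.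
  NotBelow : ℕ → Vtx n → Set
  NotBelow o (u i) = o ℕ.≤ toℕ i
  NotBelow o _     = ⊤

  NotBelow-zero : ∀ v → NotBelow 0 v
  NotBelow-zero (u i)  = ℕ.z≤n
  NotBelow-zero (m j)  = tt
  NotBelow-zero (m' j) = tt
  NotBelow-zero t      = tt

  NotBelow-next : ∀ {i j} → i ≡ inject₁ j →
                  ∀ {v} → NotBelow (toℕ i) v × u i ≢ v → NotBelow (toℕ (suc j)) v
  NotBelow-next i≡j {u i′} (i≤i′ , i≢i′) =
    subst (ℕ._< toℕ i′) (toℕ-hub i≡j) (ℕP.≤∧≢⇒< i≤i′ (λ i≡i′ → i≢i′ (cong u (toℕ-injective i≡i′))))
  NotBelow-next i≡j {m j}  _ = tt
  NotBelow-next i≡j {m' j} _ = tt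
  NotBelow-next i≡j {t}    _ = tt

  data Hop (i : Fin (suc n)) : Vtx n → Vtx n → Set where
    hop : ∀ bb j → i ≡ inject₁ j → Hop i (mid bb j) (u (suc j))

  first-hop : ∀ {i} v w {vs} → Is-just (weight (u i) v) → Is-just (weight v w) →
              Unique (u i ∷ v ∷ w ∷ vs) → NotBelow (toℕ i) w → Hop i v w
  first-hop {i} v w i~v v~w ((_ ∷ i≢w ∷ _) ∷ _) w-nb with hub-neighbour i v i~v
  ... | toSink i≡n = ⊥-elim (i≢w (trans (cong u i≡n) (sym (sink-neighbour w v~w))))
  ... | forward bb j i≡j with mid-neighbour bb j w v~w
  ...   | inj₁ w≡j = ⊥-elim (i≢w (trans (cong u i≡j) (sym w≡j)))
  ...   | inj₂ refl = hop bb j i≡j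
  first-hop {i} v w i~v v~w ((_ ∷ i≢w ∷ _) ∷ _) w-nb | backward bb j i≡1+j with mid-neighbour bb j w v~w
  ...   | inj₁ refl = ⊥-elim (ℕP.<-irrefl refl (subst₂ ℕ._≤_ (cong toℕ i≡1+j) (toℕ-inject₁ j) w-nb))
  ...   | inj₂ w≡1+j = ⊥-elim (i≢w (trans (cong u i≡1+j) (sym w≡1+j)))

  path⇒route : ∀ {k i} {f : Fin k → Fin n} → Gaps i f → toℕ i ℕ.+ k ≡ n →
    ∀ vs → IsWalk G (u i) vs → Unique (u i ∷ vs) → All (NotBelow (toℕ i)) vs →
    lastV G (u i) vs ≡ u (fromℕ n) → Σ (Vec Bool k) (λ I → vs ≡ route I f)
  path⇒route {zero}  gaps span [] _ _ _ _    = [] , refl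
  path⇒route {suc k} gaps span [] _ _ _ refl =
    ⊥-elim (ℕP.m+1+n≢m n (trans (cong (ℕ._+ suc k) (sym (toℕ-fromℕ n))) span))
  path⇒route gaps span (v ∷ []) (() , _) _ _ refl
  path⇒route {zero} gaps span (v ∷ w ∷ vs) (i~v , v~w , _) uq (_ ∷ w-nb ∷ _) _
    with first-hop v w i~v v~w uq w-nb
  ... | hop bb j i≡j = ⊥-elim (fromℕ≢inject₁ (trans (sym (hub≡last span)) i≡j))
  path⇒route {suc k} gaps span (v ∷ w ∷ vs) (i~v , v~w , walk)
             uq@((_ ∷ _ ∷ i∉vs) ∷ _ ∷ uq′) (_ ∷ w-nb ∷ nb) last
    with first-hop v w i~v v~w uq w-nb
  ... | hop bb j i≡j
    with path⇒route (Gaps-next gaps i≡j) (span-next span i≡j) vs walk uq′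
                    (All-zipWith (NotBelow-next i≡j) (nb , i∉vs)) last
  ...   | I , vs≡route = bb ∷ I , cong₂ (λ x ws → mid bb x ∷ u (suc x) ∷ ws) (Gaps-gap gaps i≡j) vs≡route

  w-entry : ∀ bb j → w G (u (inject₁ j)) (mid bb j) ≡ wt (entryCoeff bb) j
  w-entry bb j = cong (fromMaybe 0ℚ) (weight-entry bb j)

  w-exit : ∀ bb j → w G (mid bb j) (u (suc j)) ≡ wt (exitCoeff bb) j
  w-exit bb j = cong (fromMaybe 0ℚ) (weight-exit bb j)

  greedyGo-hop : ∀ bb j X vs → + X ℤ.≤ L →
    greedyGo G (toℚ (+ X)) (u (inject₁ j)) (mid bb j ∷ u (suc j) ∷ vs)
      ≡ greedyGo G (toℚ (+ (X ℕ.+ 2 ℕ.* selected bb (a j)))) (u (suc j)) vs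
  greedyGo-hop bb j X vs X≤L = cong (λ x → greedyGo G x (u (suc j)) vs) (begin
    greedyPower (w G (mid bb j) (u (suc j))) (greedyPower (w G (u (inject₁ j)) (mid bb j)) (toℚ (+ X)))
      ≡⟨ cong₂ greedyPower (w-exit bb j) (cong (λ x → greedyPower x (toℚ (+ X))) (w-entry bb j)) ⟩
    greedyPower (toℚ (L + + (exitCoeff bb ℕ.* a j))) (greedyPower (toℚ (L + + p)) (toℚ (+ X)))
      ≡⟨ cong (λ c → greedyPower (toℚ (L + + c)) (greedyPower (toℚ (L + + p)) (toℚ (+ X))))
              (exitCoeff-*-entry bb (a j)) ⟩
    greedyPower (toℚ (L + + (p ℕ.+ d))) (greedyPower (toℚ (L + + p)) (toℚ (+ X)))
      ≡⟨ greedyPower-twice L p d X X≤L ⟩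
    toℚ (+ (X ℕ.+ d)) ∎)
    where
    open ≡-Reasoning
    p d : ℕ
    p = entryCoeff bb ℕ.* a j
    d = 2 ℕ.* selected bb (a j)

  greedyGo-route : ∀ {k i} (I : Vec Bool k) {f} → Gaps i f → ∀ X →
    + (X ℕ.+ 2 ℕ.* sumOver I (a ∘ f)) ℤ.≤ L →
    greedyGo G (toℚ (+ X)) (u i) (route I f) ≡ toℚ (+ (X ℕ.+ 2 ℕ.* sumOver I (a ∘ f)))
  greedyGo-route []                 gaps X _     = cong (λ y → toℚ (+ y)) (sym (ℕP.+-identityʳ X))
  greedyGo-route {i = i} (bb ∷ I) {f} gaps X bound = begin
    greedyGo G (toℚ (+ X)) (u i) (route (bb ∷ I) f)
      ≡⟨ cong (λ x → greedyGo G (toℚ (+ X)) (u x) (route (bb ∷ I) f)) (Gaps-entry gaps) ⟩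
    greedyGo G (toℚ (+ X)) (u (inject₁ (f zero))) (route (bb ∷ I) f)
      ≡⟨ greedyGo-hop bb (f zero) X (route I (f ∘ suc)) (ℤP.≤-trans (ℤ.+≤+ (ℕP.m≤m+n X _)) bound) ⟩
    greedyGo G (toℚ (+ X′)) (u (suc (f zero))) (route I (f ∘ suc))
      ≡⟨ greedyGo-route I (Gaps-tail gaps) X′ (subst (λ y → + y ℤ.≤ L) (sym regroup) bound) ⟩
    toℚ (+ (X′ ℕ.+ 2 ℕ.* sumOver I (a ∘ f ∘ suc)))
      ≡⟨ cong (λ y → toℚ (+ y)) regroup ⟩
    toℚ (+ (X ℕ.+ 2 ℕ.* sumOver (bb ∷ I) (a ∘ f))) ∎
    where
    open ≡-Reasoning
    σ X′ : ℕ
    σ = selected bb (a (f zero))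
    X′ = X ℕ.+ 2 ℕ.* σ
    regroup : X′ ℕ.+ 2 ℕ.* sumOver I (a ∘ f ∘ suc) ≡ X ℕ.+ 2 ℕ.* sumOver (bb ∷ I) (a ∘ f)
    regroup = begin
      X ℕ.+ 2 ℕ.* σ ℕ.+ 2 ℕ.* sumOver I (a ∘ f ∘ suc)   ≡⟨ ℕP.+-assoc X _ _ ⟩
      X ℕ.+ (2 ℕ.* σ ℕ.+ 2 ℕ.* sumOver I (a ∘ f ∘ suc)) ≡⟨ cong (X ℕ.+_) (ℕP.*-distribˡ-+ 2 σ _) ⟨
      X ℕ.+ 2 ℕ.* (σ ℕ.+ sumOver I (a ∘ f ∘ suc))       ≡⟨ cong (λ y → X ℕ.+ 2 ℕ.* y) (sumOver-∷ bb I (a ∘ f)) ⟨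
      X ℕ.+ 2 ℕ.* sumOver (bb ∷ I) (a ∘ f)               ∎

  HopActivated : (Vtx n → ℚ) → Bool → Fin n → Set
  HopActivated p bb j = (wt (entryCoeff bb) j ℚ.≤ p (u (inject₁ j)) ℚ.+ p (mid bb j))
                      × (wt (exitCoeff bb) j ℚ.≤ p (mid bb j) ℚ.+ p (u (suc j)))

  route-activates : ∀ {k i} (I : Vec Bool k) {f} p → Gaps i f →
    ActivatesAll G p (u i) (route I f) ⇔ (∀ h → HopActivated p (lookup I h) (f h))
  route-activates []           p gaps = mk⇔ (λ _ ()) (λ _ → tt)
  route-activates (bb ∷ I) {f} p gaps =
    subst (λ x → ActivatesAll G p (u x) (route (bb ∷ I) f) ⇔ _) (sym (Gaps-entry gaps))
          (mk⇔ activates⇒hops hops⇒activates)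
    where
    j : Fin n
    j = f zero
    tail⇔ : ActivatesAll G p (u (suc j)) (route I (f ∘ suc)) ⇔ (∀ h → HopActivated p (lookup I h) (f (suc h)))
    tail⇔ = route-activates I p (Gaps-tail gaps)
    entryPower exitPower : ℚ
    entryPower = p (u (inject₁ j)) ℚ.+ p (mid bb j)
    exitPower  = p (mid bb j) ℚ.+ p (u (suc j))
    activates⇒hops : ActivatesAll G p (u (inject₁ j)) (route (bb ∷ I) f) →
                     ∀ h → HopActivated p (lookup (bb ∷ I) h) (f h)
    activates⇒hops (entry , exit , rest) zero    = subst (ℚ._≤ entryPower) (w-entry bb j) entry ,
                                                   subst (ℚ._≤ exitPower) (w-exit bb j) exit
    activates⇒hops (entry , exit , rest) (suc h) = Equivalence.to tail⇔ rest h
    hops⇒activates : (∀ h → HopActivated p (lookup (bb ∷ I) h) (f h)) →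
                     ActivatesAll G p (u (inject₁ j)) (route (bb ∷ I) f)
    hops⇒activates hops = subst (ℚ._≤ entryPower) (sym (w-entry bb j)) (proj₁ (hops zero)) ,
                          subst (ℚ._≤ exitPower) (sym (w-exit bb j)) (proj₂ (hops zero)) ,
                          Equivalence.from tail⇔ (hops ∘ suc)

  cost-split : ∀ p → cost G p ≡ sum (p ∘ u) ℚ.+ (sum (p ∘ m) ℚ.+ (sum (p ∘ m') ℚ.+ (p t ℚ.+ 0ℚ)))
  cost-split p = begin
    cost G p
      ≡⟨ peel u _ ⟩
    sum (p ∘ u) ℚ.+ foldr c 0ℚ (map m (allFin n) ++ map m' (allFin n) ++ t ∷ [])
      ≡⟨ cong (sum (p ∘ u) ℚ.+_) (trans (peel m _) (cong (sum (p ∘ m) ℚ.+_) (peel m' _))) ⟩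
    sum (p ∘ u) ℚ.+ (sum (p ∘ m) ℚ.+ (sum (p ∘ m') ℚ.+ (p t ℚ.+ 0ℚ))) ∎
    where
    open ≡-Reasoning
    c : Vtx n → ℚ → ℚ
    c v acc = p v ℚ.+ acc
    peel : ∀ {k} (h : Fin k → Vtx n) vs → foldr c 0ℚ (map h (allFin k) ++ vs) ≡ sum (p ∘ h) ℚ.+ foldr c 0ℚ vs
    peel h vs = trans (foldr-++ c 0ℚ (map h (allFin _)) vs) (foldr-map-allFin p h _)

  wt-mono-≤ : ∀ {e e′} j → e ℕ.≤ e′ → wt e j ℚ.≤ wt e′ j
  wt-mono-≤ j e≤e′ = toℚ-mono-≤ (ℤP.+-monoʳ-≤ L (ℤ.+≤+ (ℕP.*-monoˡ-≤ (a j) e≤e′)))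

  wt-nonNeg : + 0 ℤ.≤ L → ∀ e j → 0ℚ ℚ.≤ wt e j
  wt-nonNeg 0≤L e j = toℚ-mono-≤ (ℤP.≤-trans 0≤L (ℤP.i≤i+j L (+ (e ℕ.* a j))))

  -- The optimal assignment puts the weight of the exit edge on the chosen middle vertex of each gap.
  midLoad : Bool → Bool → Fin n → ℚ
  midLoad false false j = wt (exitCoeff false) j
  midLoad true  true  j = wt (exitCoeff true) j
  midLoad _     _     _ = 0ℚ

  optimalPower : Subset n → Vtx n → ℚ
  optimalPower I (m j)  = midLoad (lookup I j) false j
  optimalPower I (m' j) = midLoad (lookup I j) true j
  optimalPower I _      = 0ℚ

  optimalPower-mid : ∀ I bb j → optimalPower I (mid bb j) ≡ midLoad (lookup I j) bb j
  optimalPower-mid I false j = refl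
  optimalPower-mid I true  j = refl

  midLoad-diag : ∀ c j → midLoad c c j ≡ wt (exitCoeff c) j
  midLoad-diag false j = refl
  midLoad-diag true  j = refl

  midLoad-nonNeg : + 0 ℤ.≤ L → ∀ c bb j → 0ℚ ℚ.≤ midLoad c bb j
  midLoad-nonNeg 0≤L false false j = wt-nonNeg 0≤L (exitCoeff false) j
  midLoad-nonNeg 0≤L false true  j = ℚP.≤-refl
  midLoad-nonNeg 0≤L true  false j = ℚP.≤-refl
  midLoad-nonNeg 0≤L true  true  j = wt-nonNeg 0≤L (exitCoeff true) j

  midLoad-sum : ∀ c j → midLoad c false j ℚ.+ midLoad c true j ≡ wt (exitCoeff c) j
  midLoad-sum false j = ℚP.+-identityʳ _
  midLoad-sum true  j = ℚP.+-identityˡ _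

  optimalPower-nonNeg : + 0 ℤ.≤ L → ∀ I → NonNeg G (optimalPower I)
  optimalPower-nonNeg 0≤L I (u i)  = ℚP.≤-refl
  optimalPower-nonNeg 0≤L I (m j)  = midLoad-nonNeg 0≤L (lookup I j) false j
  optimalPower-nonNeg 0≤L I (m' j) = midLoad-nonNeg 0≤L (lookup I j) true j
  optimalPower-nonNeg 0≤L I t      = ℚP.≤-refl

  optimalPower-hops : ∀ I j → HopActivated (optimalPower I) (lookup I j) j
  optimalPower-hops I j =
    subst (wt (entryCoeff c) j ℚ.≤_) (sym (trans (ℚP.+-identityˡ _) load≡exit))
          (wt-mono-≤ j (entryCoeff≤exitCoeff c)) ,
    subst (wt (exitCoeff c) j ℚ.≤_) (sym (trans (ℚP.+-identityʳ _) load≡exit)) ℚP.≤-refl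
    where
    c : Bool
    c = lookup I j
    load≡exit : optimalPower I (mid c j) ≡ wt (exitCoeff c) j
    load≡exit = trans (optimalPower-mid I c j) (midLoad-diag c j)

  optimalPower-cost : ∀ I → cost G (optimalPower I) ≡ sum (λ j → wt (exitCoeff (lookup I j)) j)
  optimalPower-cost I = begin
    cost G p
      ≡⟨ cost-split p ⟩
    sum {suc n} (λ _ → 0ℚ) ℚ.+ (sum (p ∘ m) ℚ.+ (sum (p ∘ m') ℚ.+ 0ℚ))
      ≡⟨ cong₂ (λ x y → x ℚ.+ (sum (p ∘ m) ℚ.+ y))
               (sum-replicate-zero (suc n)) (ℚP.+-identityʳ (sum (p ∘ m'))) ⟩
    0ℚ ℚ.+ (sum (p ∘ m) ℚ.+ sum (p ∘ m'))
      ≡⟨ ℚP.+-identityˡ _ ⟩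
    sum (p ∘ m) ℚ.+ sum (p ∘ m')
      ≡⟨ ∑-distrib-+ (p ∘ m) (p ∘ m') ⟨
    sum (λ j → p (m j) ℚ.+ p (m' j))
      ≡⟨ sum-cong-≗ (λ j → midLoad-sum (lookup I j) j) ⟩
    sum (λ j → wt (exitCoeff (lookup I j)) j) ∎
    where
    open ≡-Reasoning
    p : Vtx n → ℚ
    p = optimalPower I

  exitWeights≤cost : ∀ I p → NonNeg G p → (∀ j → HopActivated p (lookup I j) j) →
               sum (λ j → wt (exitCoeff (lookup I j)) j) ℚ.≤ cost G p
  exitWeights≤cost I p p≥0 hops = begin
    sum (λ j → wt (exitCoeff (lookup I j)) j)
      ≤⟨ sum-mono-≤ (λ j → ℚP.≤-trans (proj₂ (hops j))
                                       (ℚP.+-monoˡ-≤ (p (u (suc j))) (mid≤m+m′ (lookup I j) j))) ⟩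
    sum (λ j → (p (m j) ℚ.+ p (m' j)) ℚ.+ p (u (suc j)))
      ≡⟨ ∑-distrib-+ (λ j → p (m j) ℚ.+ p (m' j)) (p ∘ u ∘ suc) ⟩
    sum (λ j → p (m j) ℚ.+ p (m' j)) ℚ.+ sum (p ∘ u ∘ suc)
      ≡⟨ cong (ℚ._+ sum (p ∘ u ∘ suc)) (∑-distrib-+ (p ∘ m) (p ∘ m')) ⟩
    (sum (p ∘ m) ℚ.+ sum (p ∘ m')) ℚ.+ sum (p ∘ u ∘ suc)
      ≤⟨ p≤p+q (ℚP.+-mono-≤ (p≥0 (u zero)) (p≥0 t)) ⟩
    (sum (p ∘ m) ℚ.+ sum (p ∘ m')) ℚ.+ sum (p ∘ u ∘ suc) ℚ.+ (p (u zero) ℚ.+ p t)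
      ≡⟨ solve 5 (λ A B C u₀ T → (A :+ B) :+ C :+ (u₀ :+ T) := (u₀ :+ C) :+ (A :+ (B :+ (T :+ con 0ℚ))))
               refl (sum (p ∘ m)) (sum (p ∘ m')) (sum (p ∘ u ∘ suc)) (p (u zero)) (p t) ⟩
    sum (p ∘ u) ℚ.+ (sum (p ∘ m) ℚ.+ (sum (p ∘ m') ℚ.+ (p t ℚ.+ 0ℚ)))
      ≡⟨ cost-split p ⟨
    cost G p ∎
    where
    open ℚP.≤-Reasoning
    open ℚ-Solver.+-*-Solver
    mid≤m+m′ : ∀ c j → p (mid c j) ℚ.≤ p (m j) ℚ.+ p (m' j)
    mid≤m+m′ false j = p≤p+q (p≥0 (m' j))
    mid≤m+m′ true  j = p≤q+p (p≥0 (m j))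

  route-isOpt : + 0 ℤ.≤ L → ∀ I → IsOpt G s (route I id) (sum (λ j → wt (exitCoeff (lookup I j)) j))
  route-isOpt 0≤L I =
    (optimalPower I , optimalPower-nonNeg 0≤L I ,
     Equivalence.from (route-activates I (optimalPower I) Gaps-id) (optimalPower-hops I) , optimalPower-cost I) ,
    λ p p≥0 act → exitWeights≤cost I p p≥0 (Equivalence.to (route-activates I p Gaps-id) act)

  RealisedByPath : ℚ → ℚ → Set
  RealisedByPath c r = Σ (List (Vtx n)) λ vs →
    IsPath G s vs × lastV G s vs ≡ uₙ × IsOpt G s vs c × φ G s vs ≡ r

  RealisedBySubset : ℚ → ℚ → Set
  RealisedBySubset c r = Σ (Subset n) λ I →
    r ≡ toℚ (+ (2 ℕ.* sumOver I a)) × c ≡ toℚ (+ n * L + + (2 ℕ.* sumFin a) + + sumOver I a)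

  module _ (2Σa<L : + (2 ℕ.* sumFin a) ℤ.< L) where

    route-φ : ∀ I → φ G s (route I id) ≡ toℚ (+ (2 ℕ.* sumOver I a))
    route-φ I = greedyGo-route I Gaps-id 0
      (ℤP.≤-trans (ℤ.+≤+ (ℕP.*-monoʳ-≤ 2 (sumOver≤sumFin I a))) (ℤP.<⇒≤ 2Σa<L))

    route-isOpt-closedForm : ∀ I → IsOpt G s (route I id) (toℚ (+ n * L + + (2 ℕ.* sumFin a) + + sumOver I a))
    route-isOpt-closedForm I = subst (IsOpt G s (route I id)) (exitWeight-sum L a I)
      (route-isOpt (ℤP.≤-trans (ℤ.+≤+ ℕ.z≤n) (ℤP.<⇒≤ 2Σa<L)) I)

    path⇒subset : ∀ {c r} → RealisedByPath c r → RealisedBySubset c r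
    path⇒subset (vs , (walk , unique) , last , opt , φ≡r)
      with path⇒route Gaps-id refl vs walk unique (All-universal NotBelow-zero vs) last
    ... | I , refl = I , trans (sym φ≡r) (route-φ I) , IsOpt-unique G opt (route-isOpt-closedForm I)

    subset⇒path : ∀ {c r} → RealisedBySubset c r → RealisedByPath c r
    subset⇒path (I , refl , refl) =
      route I id , (route-walk I Gaps-id , route-unique I Gaps-id) , route-last I Gaps-id refl ,
      route-isOpt-closedForm I , route-φ I

mainTheorem8 :
  (n : ℕ) (a : Fin n → ℕ) (b : ℕ) (L : ℤ) →
  (∀ i → a i ℕ.> 0) → b ℕ.> 0 → L ℤ.> + (2 ℕ.* sumFin a) →
  (c r : ℚ) →
  (Σ (List (Vtx n)) (λ vs →
      IsPath (Gadget.G n a b L) (Gadget.s n a b L) vs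
      × lastV (Gadget.G n a b L) (Gadget.s n a b L) vs ≡ Gadget.uₙ n a b L
      × IsOpt (Gadget.G n a b L) (Gadget.s n a b L) vs c
      × φ (Gadget.G n a b L) (Gadget.s n a b L) vs ≡ r))
  ⇔
  (Σ (Subset n) (λ I →
      r ≡ toℚ (+ (2 ℕ.* sumOver I a))
      × c ≡ toℚ (+ n * L + + (2 ℕ.* sumFin a) + + sumOver I a)))
mainTheorem8 n a b L _ _ 2Σa<L c r = mk⇔ (path⇒subset 2Σa<L) (subset⇒path 2Σa<L)
  where open GadgetProperties n a b L
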